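{- Let $\pi$ be a $123$-avoiding permutation. If the downcore graph of the boundary grid of $\pi$ is pure, then $\pi$ avoids $2143$.
   Context: $\pi\in S_n$ avoids $123$ if there are no indices $p<q<r$ with $\pi_p<\pi_q<\pi_r$; $\pi$ contains $2143$ if there are indices $p<q<r<s$ with $\pi_q<\pi_p<\pi_s<\pi_r$, and avoids it otherwise. $\pi_i$ is a left-to-right minimum if $\pi_j>\pi_i$ for all $j<i$, and a right-to-left maximum if $\pi_j<\pi_i$ for all $j>i$. The boundary grid of a $123$-avoiding $\pi\in S_n$ is the set of boxes $(x,y)$, $1\le x,y\le n-1$ (the box being the unit square $[x,x+1]\times[y,y+1]$, $x$ its column from the left, $y$ its row from the bottom), such that there is a left-to-right minimum $\pi_i$ with $i\le x$ and $\pi_i\le y$, and a right-to-left maximum $\pi_j$ with $j\ge x+1$ and $\pi_j\ge y+1$. The downcore graph of a set $D$ of boxes has vertex set $D$, with an edge between $(i,j)$ and $(k,\ell)$ if and only if ($i<k$ and $j>\ell$, or $i>k$ and $j<\ell$) and both $(i,\ell)$ and $(k,j)$ belong to $D$. A graph is pure if all its maximal (with respect to inclusion) independent sets have the same size. -}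

module Defs where

open import Data.Nat using (ℕ; suc; _≤_; _<_; _∸_)
open import Data.Fin using (Fin; toℕ)
open import Data.Product using (_×_; _,_; ∃; Σ)
open import Data.Sum using (_⊎_)
open import Data.List using (List; length)
open import Data.List.Membership.Propositional using (_∈_)
open import Data.List.Relation.Binary.Subset.Propositional using (_⊆_)
open import Data.List.Relation.Unary.All using (All)
open import Data.List.Relation.Unary.Unique.Propositional using (Unique)
open import Relation.Nullary using (¬_)
open import Relation.Binary.PropositionalEquality using (_≡_)
open import Function.Definitions using (Injective)

-- A permutation of [n] is an injective map Fin n → Fin n.
-- Positions and values are 0-indexed in Fin n; the paper's 1-indexed
-- position/value is toℕ _ + 1.
IsPerm : (n : ℕ) → (Fin n → Fin n) → Set
IsPerm n π = Injective _≡_ _≡_ π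

_<ᵛ_ : {n : ℕ} → Fin n → Fin n → Set
a <ᵛ b = toℕ a < toℕ b

Avoids123 : (n : ℕ) → (Fin n → Fin n) → Set
Avoids123 n π = ¬ (Σ (Fin n) λ p → Σ (Fin n) λ q → Σ (Fin n) λ r →
  p <ᵛ q × q <ᵛ r × π p <ᵛ π q × π q <ᵛ π r)

Contains2143 : (n : ℕ) → (Fin n → Fin n) → Set
Contains2143 n π = Σ (Fin n) λ p → Σ (Fin n) λ q → Σ (Fin n) λ r → Σ (Fin n) λ s →
  p <ᵛ q × q <ᵛ r × r <ᵛ s × π q <ᵛ π p × π p <ᵛ π s × π s <ᵛ π r

Avoids2143 : (n : ℕ) → (Fin n → Fin n) → Set
Avoids2143 n π = ¬ Contains2143 n π

LRMin : (n : ℕ) → (Fin n → Fin n) → Fin n → Set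
LRMin n π i = (j : Fin n) → j <ᵛ i → π i <ᵛ π j

RLMax : (n : ℕ) → (Fin n → Fin n) → Fin n → Set
RLMax n π j = (k : Fin n) → j <ᵛ k → π k <ᵛ π j

Box : Set
Box = ℕ × ℕ

-- Boundary grid (paper's 1-indexed coordinates): box (x , y) with
-- 1 ≤ x, y ≤ n-1, a LR-minimum π_i with i ≤ x, π_i ≤ y, and a
-- RL-maximum π_j with j ≥ x+1, π_j ≥ y+1.
BoundaryGrid : (n : ℕ) → (Fin n → Fin n) → Box → Set
BoundaryGrid n π (x , y) =
  1 ≤ x × x ≤ n ∸ 1 × 1 ≤ y × y ≤ n ∸ 1 ×
  (Σ (Fin n) λ i → LRMin n π i × suc (toℕ i) ≤ x × suc (toℕ (π i)) ≤ y) ×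
  (Σ (Fin n) λ j → RLMax n π j × suc x ≤ suc (toℕ j) × suc y ≤ suc (toℕ (π j)))

DowncoreEdge : (Box → Set) → Box → Box → Set
DowncoreEdge D (i , j) (k , l) =
  ((i < k × l < j) ⊎ (k < i × j < l)) × D (i , l) × D (k , j)

-- Finite vertex sets are represented by duplicate-free lists.
Independent : (Box → Set) → (Box → Box → Set) → List Box → Set
Independent V E S =
  All V S × Unique S × ((a b : Box) → a ∈ S → b ∈ S → ¬ E a b)

MaximalIndependent : (Box → Set) → (Box → Box → Set) → List Box → Set
MaximalIndependent V E S =
  Independent V E S × ((T : List Box) → Independent V E T → S ⊆ T → T ⊆ S)

Pure : (Box → Set) → (Box → Box → Set) → Set
Pure V E = (S T : List Box) → MaximalIndependent V E S →
  MaximalIndependent V E T → length S ≡ length T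

DowncorePure : (Box → Set) → Set
DowncorePure D = Pure D (DowncoreEdge D)

module Submission where

-- Suppose π contains 2143.  Using 123-avoidance we tighten the occurrence to
-- p < q < r < s with π q < π p < π s < π r, π p least left of q, π s greatest
-- right of r.  With Q = q, R = r, α = π p, δ = π s the box (Q , α) is missing
-- from the grid, and the independent sets of grid boxes
--     X = { (Q,δ) , (R,α) , (Q,δ+1) , (R+1,α) },   Y = { (Q,δ) , (R,α) , (R,δ) }
-- have closed neighbourhoods N[X] ⊆ N[Y].  In a pure graph this forces
-- |X| ≤ |Y|: extend Y greedily to a maximal independent set A ∪ Y; then A ∪ X
-- is independent too, and its maximal extensions have ≥ |A| + |X| elements.

open import Defs
open import Data.Nat using (ℕ; suc; _≤_; _<_; _+_; _∸_; _≤?_; _<?_; z≤n; s≤s; _≟_)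
open import Data.Nat.Properties
  using (≤-refl; ≤-trans; <-trans; ≤-<-trans; <-≤-trans; <⇒≤; <⇒≢; >⇒≢; ≤⇒≯; <-irrefl; ≮⇒≥;
         ≤∧≢⇒<; n<1+n; m≤n⇒m<n∨m≡n; m≤n+m; +-cancelˡ-≤; module ≤-Reasoning)
open import Data.Fin using (Fin; toℕ)
open import Data.Fin.Properties using (toℕ-injective; toℕ<n; toℕ≤pred[n]; any?; all?)
open import Data.Product using (_×_; _,_; Σ; ∃; proj₁; proj₂)
open import Data.Product.Properties using (≡-dec)
open import Data.Sum using (_⊎_; inj₁; inj₂)
import Data.Sum as Sum
open import Data.Empty using (⊥-elim)
open import Data.List using (List; []; _∷_; _++_; [_]; length; filter; allFin; upTo; cartesianProduct)
open import Data.List.Properties using (length-++; ++-assoc)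
open import Data.List.Extrema.Nat using (argmin; argmax; argmin-all; argmax-all; f[argmin]≤f[⊤]; f[argmin]≤f[xs]; f[⊥]≤f[argmax]; f[xs]≤f[argmax])
open import Data.List.Membership.Propositional using (_∈_; _∉_; find)
open import Data.List.Membership.Propositional.Properties
  using (∈-++⁺ˡ; ∈-++⁺ʳ; ∈-++⁻; ∈-filter⁺; ∈-allFin; ∈-upTo⁺; ∈-cartesianProduct⁺)
open import Data.List.Membership.DecPropositional (≡-dec _≟_ _≟_) using (_∈?_)
open import Data.List.Relation.Binary.Disjoint.Propositional using (Disjoint)
open import Data.List.Relation.Unary.Any using (here; there)
open import Data.List.Relation.Unary.All as All using (All; []; _∷_)
import Data.List.Relation.Unary.All.Properties as All
open import Data.List.Relation.Unary.AllPairs using ([]; _∷_)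
open import Data.List.Relation.Unary.Unique.Propositional using (Unique)
import Data.List.Relation.Unary.Unique.Propositional.Properties as Unique
open import Relation.Nullary using (¬_; Dec; yes; no)
open import Relation.Nullary.Decidable using (_×-dec_; _⊎-dec_; _→-dec_; ¬?)
open import Relation.Unary using (Decidable)
open import Relation.Binary using () renaming (Decidable to Decidable₂)
open import Relation.Binary.PropositionalEquality using (_≡_; _≢_; refl; sym; trans; cong; subst)

-- (1) Independent sets, closed neighbourhoods and purity

InClosedNbhd : (Box → Box → Set) → List Box → Box → Set
InClosedNbhd E S t = t ∈ S ⊎ ∃ λ s → s ∈ S × (E s t ⊎ E t s)

closedNbhd-++ : ∀ {E} A {S t} → InClosedNbhd E S t → InClosedNbhd E (A ++ S) t
closedNbhd-++ A (inj₁ t∈S) = inj₁ (∈-++⁺ʳ A t∈S)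
closedNbhd-++ A (inj₂ (s , s∈S , e)) = inj₂ (s , ∈-++⁺ʳ A s∈S , e)

unique-++ˡ : ∀ (A : List Box) {S} → Unique (A ++ S) → Unique A
unique-++ˡ [] _ = []
unique-++ˡ (_ ∷ A) (a∉ ∷ u) = All.++⁻ˡ A a∉ ∷ unique-++ˡ A u

unique-++-disjoint : ∀ (A : List Box) {S a} → Unique (A ++ S) → a ∈ A → a ∉ S
unique-++-disjoint (_ ∷ A) (a∉ ∷ _) (here refl) a∈S = All.lookup (All.++⁻ʳ A a∉) a∈S refl
unique-++-disjoint (_ ∷ A) (_ ∷ u) (there a∈A) = unique-++-disjoint A u a∈A

dominating⇒maximal : ∀ {V E M} → Independent V E M →
  (∀ {t} → V t → InClosedNbhd E M t) → MaximalIndependent V E M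
dominating⇒maximal {V} {E} {M} indM dominates = indM , noProperExtension
  where
  noProperExtension : (T : List Box) → Independent V E T → (∀ {t} → t ∈ M → t ∈ T) → ∀ {t} → t ∈ T → t ∈ M
  noProperExtension T (vT , _ , noEdgeT) M⊆T t∈T with dominates (All.lookup vT t∈T)
  ... | inj₁ t∈M = t∈M
  ... | inj₂ (s , s∈M , inj₁ e) = ⊥-elim (noEdgeT _ _ (M⊆T s∈M) t∈T e)
  ... | inj₂ (s , s∈M , inj₂ e) = ⊥-elim (noEdgeT _ _ t∈T (M⊆T s∈M) e)

prefix-outside : ∀ {V E} A {Y a} → Independent V E (A ++ Y) → a ∈ A → ¬ InClosedNbhd E Y a
prefix-outside A (_ , u , _) a∈A (inj₁ a∈Y) = unique-++-disjoint A u a∈A a∈Y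
prefix-outside A (_ , _ , noEdge) a∈A (inj₂ (y , y∈Y , inj₁ e)) = noEdge _ _ (∈-++⁺ʳ A y∈Y) (∈-++⁺ˡ a∈A) e
prefix-outside A (_ , _ , noEdge) a∈A (inj₂ (y , y∈Y , inj₂ e)) = noEdge _ _ (∈-++⁺ˡ a∈A) (∈-++⁺ʳ A y∈Y) e

exchange-independent : ∀ {V E} A {X Y} → Independent V E (A ++ Y) → Independent V E X →
  (∀ {t} → InClosedNbhd E X t → InClosedNbhd E Y t) → Independent V E (A ++ X)
exchange-independent {V} {E} A {X} indAY@(vAY , uAY , noEdgeAY) (vX , uX , noEdgeX) X⊑Y =
  All.++⁺ (All.++⁻ˡ A vAY) vX , Unique.++⁺ (unique-++ˡ A uAY) uX disjoint , noEdge
  where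
  outside : ∀ {a} → a ∈ A → ¬ InClosedNbhd E _ a
  outside = prefix-outside A indAY
  disjoint : Disjoint A X
  disjoint (a∈A , a∈X) = outside a∈A (X⊑Y (inj₁ a∈X))
  noEdge : (a b : Box) → a ∈ A ++ X → b ∈ A ++ X → ¬ E a b
  noEdge a b a∈ b∈ e with ∈-++⁻ A a∈ | ∈-++⁻ A b∈
  ... | inj₁ a∈A | inj₁ b∈A = noEdgeAY a b (∈-++⁺ˡ a∈A) (∈-++⁺ˡ b∈A) e
  ... | inj₁ a∈A | inj₂ b∈X = outside a∈A (X⊑Y (inj₂ (b , b∈X , inj₂ e)))
  ... | inj₂ a∈X | inj₁ b∈A = outside b∈A (X⊑Y (inj₂ (a , a∈X , inj₁ e)))
  ... | inj₂ a∈X | inj₂ b∈X = noEdgeX a b a∈X b∈X e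

module Greedy (V : Box → Set) (E : Box → Box → Set)
              (V? : Decidable V) (E? : Decidable₂ E) (E-irrefl : ∀ t → ¬ E t t)
              (L : List Box) (L-complete : ∀ t → V t → t ∈ L) where

  Addable : List Box → Box → Set
  Addable S t = V t × t ∉ S × All (λ s → ¬ E t s × ¬ E s t) S

  addable? : ∀ S t → Dec (Addable S t)
  addable? S t = V? t ×-dec ¬? (t ∈? S) ×-dec All.all? (λ s → ¬? (E? t s) ×-dec ¬? (E? s t)) S

  add-independent : ∀ {S t} → Independent V E S → Addable S t → Independent V E (t ∷ S)
  add-independent {S} {t} (vS , uS , noEdge) (vt , t∉S , apart) =
    (vt ∷ vS) , (All.¬Any⇒All¬ S t∉S ∷ uS) , noEdge′
    where
    noEdge′ : (a b : Box) → a ∈ t ∷ S → b ∈ t ∷ S → ¬ E a b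
    noEdge′ _ _ (here refl) (here refl) = E-irrefl t
    noEdge′ _ _ (here refl) (there b∈S) = proj₁ (All.lookup apart b∈S)
    noEdge′ _ _ (there a∈S) (here refl) = proj₂ (All.lookup apart a∈S)
    noEdge′ a b (there a∈S) (there b∈S) = noEdge a b a∈S b∈S

  non-addable : ∀ {S t} → V t → ¬ Addable S t → InClosedNbhd E S t
  non-addable {S} {t} vt ¬addable with t ∈? S
  ... | yes t∈S = inj₁ t∈S
  ... | no t∉S with find (All.¬All⇒Any¬ (λ s → ¬? (E? t s) ×-dec ¬? (E? s t)) S
                           (λ apart → ¬addable (vt , t∉S , apart)))
  ...   | s , s∈S , ¬apart with E? t s | E? s t
  ...     | yes e | _ = inj₂ (s , s∈S , inj₂ e)
  ...     | no _ | yes e = inj₂ (s , s∈S , inj₁ e)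
  ...     | no ¬e₁ | no ¬e₂ = ⊥-elim (¬apart (¬e₁ , ¬e₂))

  extend : List Box → List Box → List Box
  extend S [] = S
  extend S (t ∷ ts) with addable? S t
  ... | yes _ = extend (t ∷ S) ts
  ... | no _ = extend S ts

  extend-prepends : ∀ S ts → ∃ λ A → extend S ts ≡ A ++ S
  extend-prepends S [] = [] , refl
  extend-prepends S (t ∷ ts) with addable? S t
  ... | no _ = extend-prepends S ts
  ... | yes _ with extend-prepends (t ∷ S) ts
  ...   | A , eq = A ++ [ t ] , trans eq (sym (++-assoc A [ t ] S))

  extend-independent : ∀ S ts → Independent V E S → Independent V E (extend S ts)
  extend-independent S [] indS = indS
  extend-independent S (t ∷ ts) indS with addable? S t
  ... | yes addable = extend-independent (t ∷ S) ts (add-independent indS addable)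
  ... | no _ = extend-independent S ts indS

  extend-keeps : ∀ S ts {t} → InClosedNbhd E S t → InClosedNbhd E (extend S ts) t
  extend-keeps S ts {t} inN with extend-prepends S ts
  ... | A , eq = subst (λ M → InClosedNbhd E M t) (sym eq) (closedNbhd-++ {E} A inN)

  extend-covers : ∀ S ts {t} → t ∈ ts → V t → InClosedNbhd E (extend S ts) t
  extend-covers S (x ∷ ts) t∈ vt with addable? S x
  extend-covers S (x ∷ ts) (here refl) vt | yes _ = extend-keeps (x ∷ S) ts (inj₁ (here refl))
  extend-covers S (x ∷ ts) (there t∈) vt | yes _ = extend-covers (x ∷ S) ts t∈ vt
  extend-covers S (x ∷ ts) (here refl) vt | no ¬addable = extend-keeps S ts (non-addable vt ¬addable)
  extend-covers S (x ∷ ts) (there t∈) vt | no _ = extend-covers S ts t∈ vt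

  extend-maximal : ∀ S → Independent V E S → MaximalIndependent V E (extend S L)
  extend-maximal S indS = dominating⇒maximal (extend-independent S L indS)
    (λ {t} vt → extend-covers S L (L-complete t vt) vt)

  pure⇒size-bound : Pure V E → ∀ {X Y} → Independent V E X → Independent V E Y →
    (∀ {t} → InClosedNbhd E X t → InClosedNbhd E Y t) → length X ≤ length Y
  pure⇒size-bound pure {X} {Y} indX indY X⊑Y
    with A , eqA ← extend-prepends Y L
    with B , eqB ← extend-prepends (A ++ X) L =
    +-cancelˡ-≤ (length A) _ _ (begin
      length A + length X            ≡⟨ sym (length-++ A) ⟩
      length (A ++ X)                ≤⟨ m≤n+m _ (length B) ⟩
      length B + length (A ++ X)     ≡⟨ sym (length-++ B) ⟩
      length (B ++ A ++ X)           ≡⟨ cong length (sym eqB) ⟩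
      length (extend (A ++ X) L)     ≡⟨ pure _ _ (extend-maximal _ indAX) (extend-maximal Y indY) ⟩
      length (extend Y L)            ≡⟨ cong length eqA ⟩
      length (A ++ Y)                ≡⟨ length-++ A ⟩
      length A + length Y            ∎)
    where
    open ≤-Reasoning
    indAX : Independent V E (A ++ X)
    indAX = exchange-independent A (subst (Independent V E) eqA (extend-independent Y L indY)) indX X⊑Y

-- (2) The boundary grid as a finite graph.

inBoundaryGrid : ∀ {n π x y} {i j : Fin n} → LRMin n π i → RLMax n π j →
  toℕ i < x → toℕ (π i) < y → x ≤ toℕ j → y ≤ toℕ (π j) → BoundaryGrid n π (x , y)
inBoundaryGrid {π = π} {i = i} {j} i-min j-max i<x πi<y x≤j y≤πj =
  ≤-trans (s≤s z≤n) i<x , ≤-trans x≤j (toℕ≤pred[n] j) ,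
  ≤-trans (s≤s z≤n) πi<y , ≤-trans y≤πj (toℕ≤pred[n] (π j)) ,
  (i , i-min , i<x , πi<y) , (j , j-max , s≤s x≤j , s≤s y≤πj)

boundaryGrid? : ∀ n (π : Fin n → Fin n) → Decidable (BoundaryGrid n π)
boundaryGrid? n π (x , y) =
  (1 ≤? x) ×-dec (x ≤? n ∸ 1) ×-dec (1 ≤? y) ×-dec (y ≤? n ∸ 1) ×-dec
  any? (λ i → lrMin? i ×-dec (suc (toℕ i) ≤? x) ×-dec (suc (toℕ (π i)) ≤? y)) ×-dec
  any? (λ j → rlMax? j ×-dec (suc x ≤? suc (toℕ j)) ×-dec (suc y ≤? suc (toℕ (π j))))
  where
  lrMin? : ∀ i → Dec (LRMin n π i)
  lrMin? i = all? (λ j → (toℕ j <? toℕ i) →-dec (toℕ (π i) <? toℕ (π j)))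
  rlMax? : ∀ j → Dec (RLMax n π j)
  rlMax? j = all? (λ k → (toℕ j <? toℕ k) →-dec (toℕ (π k) <? toℕ (π j)))

gridBoxes : ℕ → List Box
gridBoxes n = cartesianProduct (upTo n) (upTo n)

gridBoxes-complete : ∀ n π b → BoundaryGrid n π b → b ∈ gridBoxes n
gridBoxes-complete n π (x , y) (_ , _ , _ , _ , _ , (j , _ , s≤s x≤j , s≤s y≤πj)) =
  ∈-cartesianProduct⁺ (∈-upTo⁺ (≤-<-trans x≤j (toℕ<n j))) (∈-upTo⁺ (≤-<-trans y≤πj (toℕ<n (π j))))

downcoreEdge? : ∀ {D} → Decidable D → Decidable₂ (DowncoreEdge D)
downcoreEdge? D? (i , j) (k , l) =
  (((i <? k) ×-dec (l <? j)) ⊎-dec ((k <? i) ×-dec (j <? l))) ×-dec D? (i , l) ×-dec D? (k , j)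

downcoreEdge-irrefl : ∀ {D} t → ¬ DowncoreEdge D t t
downcoreEdge-irrefl _ (inj₁ (i<i , _) , _) = <-irrefl refl i<i
downcoreEdge-irrefl _ (inj₂ (i<i , _) , _) = <-irrefl refl i<i

downcoreEdge-sym : ∀ {D a b} → DowncoreEdge D a b → DowncoreEdge D b a
downcoreEdge-sym (order , corner₁ , corner₂) = Sum.swap order , corner₂ , corner₁

Separated : (Box → Set) → Box → Box → Set
Separated D (x , y) (x' , y') = x ≡ x' ⊎ y ≡ y' ⊎ ¬ D (x , y') ⊎ ¬ D (x' , y)

separated⇒no-edge : ∀ {D} a b → Separated D a b → ¬ DowncoreEdge D a b
separated⇒no-edge _ _ (inj₁ refl) (inj₁ (x<x , _) , _) = <-irrefl refl x<x
separated⇒no-edge _ _ (inj₁ refl) (inj₂ (x<x , _) , _) = <-irrefl refl x<x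
separated⇒no-edge _ _ (inj₂ (inj₁ refl)) (inj₁ (_ , y<y) , _) = <-irrefl refl y<y
separated⇒no-edge _ _ (inj₂ (inj₁ refl)) (inj₂ (_ , y<y) , _) = <-irrefl refl y<y
separated⇒no-edge _ _ (inj₂ (inj₂ (inj₁ missing))) (_ , corner , _) = missing corner
separated⇒no-edge _ _ (inj₂ (inj₂ (inj₂ missing))) (_ , _ , corner) = missing corner

separated⇒independent : ∀ {D S} → All D S → Unique S →
  (∀ {a b} → a ∈ S → b ∈ S → Separated D a b) → Independent D (DowncoreEdge D) S
separated⇒independent {D} inD unique separated =
  inD , unique , λ a b a∈ b∈ → separated⇒no-edge {D} a b (separated a∈ b∈)

column-≢ : ∀ {x y x' y' : ℕ} → x ≢ x' → (x , y) ≢ (x' , y')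
column-≢ x≢x' refl = x≢x' refl

row-≢ : ∀ {x y x' y' : ℕ} → y ≢ y' → (x , y) ≢ (x' , y')
row-≢ y≢y' refl = y≢y' refl

-- (3) Tightening a 2143-occurrence in a 123-avoiding permutation.

value-<-from-≤ : ∀ {n π} → IsPerm n π → ∀ {a b} → toℕ a ≢ toℕ b → toℕ (π a) ≤ toℕ (π b) → π a <ᵛ π b
value-<-from-≤ inj a≢b le = ≤∧≢⇒< le (λ eq → a≢b (cong toℕ (inj (toℕ-injective eq))))

value-<-from-≮ : ∀ {n π} → IsPerm n π → ∀ {a b} → toℕ a ≢ toℕ b → ¬ (π b <ᵛ π a) → π a <ᵛ π b
value-<-from-≮ inj a≢b ≮ = value-<-from-≤ inj a≢b (≮⇒≥ ≮)

ascent-bottom-lrMin : ∀ {n π} → IsPerm n π → Avoids123 n π →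
  ∀ {q r} → q <ᵛ r → π q <ᵛ π r → LRMin n π q
ascent-bottom-lrMin inj avoids {q} {r} q<r πq<πr j j<q =
  value-<-from-≮ inj (>⇒≢ j<q) (λ πj<πq → avoids (j , q , r , j<q , q<r , πj<πq , πq<πr))

ascent-top-rlMax : ∀ {n π} → IsPerm n π → Avoids123 n π →
  ∀ {q r} → q <ᵛ r → π q <ᵛ π r → RLMax n π r
ascent-top-rlMax inj avoids {q} {r} q<r πq<πr k r<k =
  value-<-from-≮ inj (>⇒≢ r<k) (λ πr<πk → avoids (q , r , k , q<r , r<k , πq<πr , πr<πk))

leftMinimum : ∀ {n} (π : Fin n → Fin n) {p q : Fin n} → p <ᵛ q →
  Σ (Fin n) λ a → a <ᵛ q × toℕ (π a) ≤ toℕ (π p) × (∀ t → t <ᵛ q → toℕ (π a) ≤ toℕ (π t))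
leftMinimum {n} π {p} {q} p<q =
  a , argmin-all value p<q (All.all-filter left? (allFin n)) , f[argmin]≤f[⊤] {f = value} p left ,
  λ t t<q → All.lookup (f[argmin]≤f[xs] {f = value} p left) (∈-filter⁺ left? (∈-allFin t) t<q)
  where
  value : Fin n → ℕ
  value t = toℕ (π t)
  left? : Decidable (_<ᵛ q)
  left? t = toℕ t <? toℕ q
  left : List (Fin n)
  left = filter left? (allFin n)
  a : Fin n
  a = argmin value p left

rightMaximum : ∀ {n} (π : Fin n → Fin n) {r s : Fin n} → r <ᵛ s →
  Σ (Fin n) λ d → r <ᵛ d × toℕ (π s) ≤ toℕ (π d) × (∀ t → r <ᵛ t → toℕ (π t) ≤ toℕ (π d))
rightMaximum {n} π {r} {s} r<s =
  d , argmax-all value r<s (All.all-filter right? (allFin n)) , f[⊥]≤f[argmax] {f = value} s right ,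
  λ t r<t → All.lookup (f[xs]≤f[argmax] {f = value} s right) (∈-filter⁺ right? (∈-allFin t) r<t)
  where
  value : Fin n → ℕ
  value t = toℕ (π t)
  right? : Decidable (r <ᵛ_)
  right? t = toℕ r <? toℕ t
  right : List (Fin n)
  right = filter right? (allFin n)
  d : Fin n
  d = argmax value s right

record Tight2143 (n : ℕ) (π : Fin n → Fin n) : Set where
  field
    p q r s : Fin n
    p<q : p <ᵛ q
    q<r : q <ᵛ r
    r<s : r <ᵛ s
    πq<πp : π q <ᵛ π p
    πp<πs : π p <ᵛ π s
    πs<πr : π s <ᵛ π r
    p-leftMin : ∀ t → t <ᵛ q → toℕ (π p) ≤ toℕ (π t)
    s-rightMax : ∀ t → r <ᵛ t → toℕ (π t) ≤ toℕ (π s)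
    p-lrMin : LRMin n π p
    q-lrMin : LRMin n π q
    r-rlMax : RLMax n π r
    s-rlMax : RLMax n π s

-- Replace p by the minimum left of q and s by the maximum right of r;
-- 123-avoidance keeps the 2143 shape and yields the extremal entries.
tighten : ∀ {n π} → IsPerm n π → Avoids123 n π → Contains2143 n π → Tight2143 n π
tighten {π = π} inj avoids (p , q , r , s , p<q , q<r , r<s , πq<πp , πp<πs , πs<πr)
  with a , a<q , πa≤πp , a-min ← leftMinimum π p<q
  with d , r<d , πs≤πd , d-max ← rightMaximum π r<s = record
  { p = a ; q = q ; r = r ; s = d
  ; p<q = a<q ; q<r = q<r ; r<s = r<d
  ; πq<πp = value-<-from-≮ inj (>⇒≢ a<q) (λ πa<πq → avoids (a , q , r , a<q , q<r , πa<πq , πq<πr))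
  ; πp<πs = ≤-<-trans πa≤πp (<-≤-trans πp<πs πs≤πd)
  ; πs<πr = value-<-from-≮ inj (>⇒≢ r<d) (λ πr<πd → avoids (q , r , d , q<r , r<d , πq<πr , πr<πd))
  ; p-leftMin = a-min ; s-rightMax = d-max
  ; p-lrMin = λ j j<a → value-<-from-≤ inj (>⇒≢ j<a) (a-min j (<-trans j<a a<q))
  ; q-lrMin = ascent-bottom-lrMin inj avoids q<r πq<πr
  ; r-rlMax = ascent-top-rlMax inj avoids q<r πq<πr
  ; s-rlMax = λ k d<k → value-<-from-≤ inj (>⇒≢ d<k) (d-max k (<-trans r<d d<k))
  }
  where
  πq<πr : π q <ᵛ π r
  πq<πr = <-trans πq<πp (<-trans πp<πs πs<πr)

-- (4) The sets X and Y in the boundary grid of a tight 2143-occurrence.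
module TightConfiguration {n : ℕ} {π : Fin n → Fin n} (inj : IsPerm n π) (T : Tight2143 n π) where
  open Tight2143 T

  D : Box → Set
  D = BoundaryGrid n π

  E : Box → Box → Set
  E = DowncoreEdge D

  Q R α γ δ : ℕ
  Q = toℕ q
  R = toℕ r
  α = toℕ (π p)
  γ = toℕ (π r)
  δ = toℕ (π s)

  α<γ : α < γ
  α<γ = <-trans πp<πs πs<πr

  -- No LR-minimum left of q lies below α, so the box (Q , α) is missing.
  corner-missing : ¬ D (Q , α)
  corner-missing (_ , _ , _ , _ , (i , _ , i<Q , πi<α) , _) = ≤⇒≯ (p-leftMin i i<Q) πi<α

  -- Boxes in column Q or row α are pairwise separated by the missing corner.
  OnCross : Box → Set
  OnCross (x , y) = x ≡ Q ⊎ y ≡ α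

  cross-separated : ∀ {a b} → OnCross a → OnCross b → Separated D a b
  cross-separated (inj₁ refl) (inj₁ refl) = inj₁ refl
  cross-separated (inj₁ refl) (inj₂ refl) = inj₂ (inj₂ (inj₁ corner-missing))
  cross-separated (inj₂ refl) (inj₁ refl) = inj₂ (inj₂ (inj₂ corner-missing))
  cross-separated (inj₂ refl) (inj₂ refl) = inj₂ (inj₁ refl)

  c₁ c₂ v u w : Box
  c₁ = Q , δ
  c₂ = R , α
  v = R , δ
  u = Q , suc δ
  w = suc R , α

  c₁∈D : D c₁
  c₁∈D = inBoundaryGrid p-lrMin s-rlMax p<q πp<πs (<⇒≤ (<-trans q<r r<s)) ≤-refl
  c₂∈D : D c₂
  c₂∈D = inBoundaryGrid q-lrMin r-rlMax q<r πq<πp ≤-refl (<⇒≤ α<γ)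
  v∈D : D v
  v∈D = inBoundaryGrid p-lrMin s-rlMax (<-trans p<q q<r) πp<πs (<⇒≤ r<s) ≤-refl
  u∈D : D u
  u∈D = inBoundaryGrid p-lrMin r-rlMax p<q (s≤s (<⇒≤ πp<πs)) (<⇒≤ q<r) πs<πr
  w∈D : D w
  w∈D = inBoundaryGrid q-lrMin s-rlMax (s≤s (<⇒≤ q<r)) πq<πp r<s (<⇒≤ πp<πs)

  X Y : List Box
  X = c₁ ∷ c₂ ∷ u ∷ w ∷ []
  Y = c₁ ∷ c₂ ∷ v ∷ []

  c₁∈Y : c₁ ∈ Y
  c₁∈Y = here refl
  c₂∈Y : c₂ ∈ Y
  c₂∈Y = there (here refl)
  v∈Y : v ∈ Y
  v∈Y = there (there (here refl))

  X-independent : Independent D E X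
  X-independent = separated⇒independent (c₁∈D ∷ c₂∈D ∷ u∈D ∷ w∈D ∷ [])
    ((column-≢ (<⇒≢ q<r) ∷ row-≢ (<⇒≢ (n<1+n δ)) ∷ column-≢ (<⇒≢ Q<1+R) ∷ []) ∷
     (column-≢ (>⇒≢ q<r) ∷ column-≢ (<⇒≢ (n<1+n R)) ∷ []) ∷
     (column-≢ (<⇒≢ Q<1+R) ∷ []) ∷ [] ∷ [])
    (λ a∈X b∈X → cross-separated (All.lookup onCross a∈X) (All.lookup onCross b∈X))
    where
    Q<1+R : Q < suc R
    Q<1+R = <-trans q<r (n<1+n R)
    onCross : All OnCross X
    onCross = inj₁ refl ∷ inj₂ refl ∷ inj₁ refl ∷ inj₂ refl ∷ []

  Y-independent : Independent D E Y
  Y-independent = separated⇒independent (c₁∈D ∷ c₂∈D ∷ v∈D ∷ [])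
    ((column-≢ (<⇒≢ q<r) ∷ column-≢ (<⇒≢ q<r) ∷ []) ∷ (row-≢ (<⇒≢ πp<πs) ∷ []) ∷ [] ∷ [])
    separated
    where
    separated : ∀ {a b} → a ∈ Y → b ∈ Y → Separated D a b
    separated (here refl) (here refl) = inj₁ refl
    separated (here refl) (there (here refl)) = cross-separated (inj₁ refl) (inj₂ refl)
    separated (here refl) (there (there (here refl))) = inj₂ (inj₁ refl)
    separated (there (here refl)) (here refl) = cross-separated (inj₂ refl) (inj₁ refl)
    separated (there (here refl)) (there (here refl)) = inj₁ refl
    separated (there (here refl)) (there (there (here refl))) = inj₁ refl
    separated (there (there (here refl))) (here refl) = inj₂ (inj₁ refl)
    separated (there (there (here refl))) (there (here refl)) = inj₁ refl
    separated (there (there (here refl))) (there (there (here refl))) = inj₁ refl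

  u~v : E u v
  u~v = inj₁ (q<r , n<1+n δ) , c₁∈D ,
        inBoundaryGrid p-lrMin r-rlMax (<-trans p<q q<r) (s≤s (<⇒≤ πp<πs)) ≤-refl πs<πr

  v~w : E v w
  v~w = inj₁ (n<1+n R , πp<πs) , c₂∈D ,
        inBoundaryGrid q-lrMin s-rlMax (<-trans q<r (n<1+n R)) (<-trans πq<πp πp<πs) r<s ≤-refl

  -- Every box of the rectangle Q < x ≤ R, α < y ≤ δ (whose north-east corner
  -- is v) lies in N[Y]: below row δ it is adjacent to c₁, in row δ to c₂.
  rectangle⊑Y : ∀ {x y} → Q < x → x ≤ R → α < y → y ≤ δ → InClosedNbhd E Y (x , y)
  rectangle⊑Y {x} {y} Q<x x≤R α<y y≤δ with m≤n⇒m<n∨m≡n y≤δ | m≤n⇒m<n∨m≡n x≤R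
  ... | inj₁ y<δ | _ = inj₂ (c₁ , c₁∈Y , inj₁ (inj₁ (Q<x , y<δ) ,
          inBoundaryGrid p-lrMin r-rlMax p<q α<y (<⇒≤ q<r) (≤-trans y≤δ (<⇒≤ πs<πr)) ,
          inBoundaryGrid p-lrMin s-rlMax (<-trans p<q Q<x) πp<πs (≤-trans x≤R (<⇒≤ r<s)) ≤-refl))
  ... | inj₂ refl | inj₁ x<R = inj₂ (c₂ , c₂∈Y , inj₂ (inj₁ (x<R , πp<πs) ,
          inBoundaryGrid q-lrMin r-rlMax Q<x πq<πp x≤R (<⇒≤ α<γ) , v∈D))
  ... | inj₂ refl | inj₂ refl = inj₁ v∈Y

  u-neighbours : ∀ {x y} → E u (x , y) → InClosedNbhd E Y (x , y)
  u-neighbours (inj₁ (Q<x , s≤s y≤δ) , (_ , _ , _ , _ , (i , _ , i<Q , πi<y) , _) ,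
                (_ , _ , _ , _ , _ , (j , _ , s≤s x≤j , s≤s δ<πj))) =
    rectangle⊑Y Q<x (≤-trans x≤j j≤R) (≤-<-trans (p-leftMin i i<Q) πi<y) y≤δ
    where
    -- the RL-maximum j lies above δ, so it is not right of r
    j≤R : toℕ j ≤ R
    j≤R = ≮⇒≥ (λ R<j → ≤⇒≯ (s-rightMax j R<j) δ<πj)
  u-neighbours {x} {y} (inj₂ (x<Q , δ+1<y) , Qy∈D ,
                        (_ , _ , _ , _ , (i , i-min , i<x , s≤s πi≤δ) , _)) =
    inj₂ (c₁ , c₁∈Y , inj₂ (inj₁ (x<Q , <-trans (n<1+n δ) δ+1<y) ,
      inBoundaryGrid i-min s-rlMax i<x πi<δ (<⇒≤ x<S) ≤-refl , Qy∈D))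
    where
    -- a neighbour north-west of u is adjacent to c₁, since (x , δ) ∈ D
    x<S : x < toℕ s
    x<S = <-trans x<Q (<-trans q<r r<s)
    πi<δ : toℕ (π i) < δ
    πi<δ = value-<-from-≤ inj (<⇒≢ (<-trans i<x x<S)) πi≤δ

  w-neighbours : ∀ {x y} → E (x , y) w → InClosedNbhd E Y (x , y)
  w-neighbours (inj₁ (s≤s x≤R , α<y) , (_ , _ , _ , _ , (i , _ , i<x , πi<α) , _) ,
                (_ , _ , _ , _ , _ , (j , _ , s≤s R<j , s≤s y≤πj))) =
    rectangle⊑Y (≤-<-trans Q≤i i<x) x≤R α<y (≤-trans y≤πj (s-rightMax j R<j))
    where
    -- the LR-minimum i lies below α, so it is not left of q
    Q≤i : Q ≤ toℕ i
    Q≤i = ≮⇒≥ (λ i<Q → ≤⇒≯ (p-leftMin i i<Q) πi<α)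
  w-neighbours {x} {y} (inj₂ (1+R<x , y<α) , xα∈D ,
                        (_ , _ , _ , _ , (i , i-min , s≤s i≤R , πi<y) , _)) =
    inj₂ (c₂ , c₂∈Y , inj₁ (inj₁ (<-trans (n<1+n R) 1+R<x , y<α) ,
      inBoundaryGrid i-min r-rlMax i<R πi<y ≤-refl (<⇒≤ (<-trans y<α α<γ)) , xα∈D))
    where
    -- a neighbour south-east of w is adjacent to c₂, since (R , y) ∈ D;
    -- here i ≠ r because π i < y < α < γ = π r
    i<R : toℕ i < R
    i<R = ≤∧≢⇒< i≤R (λ i≡R → <-irrefl (cong (λ k → toℕ (π k)) (toℕ-injective i≡R))
                                        (<-trans πi<y (<-trans y<α α<γ)))

  X⊑Y : ∀ {t} → InClosedNbhd E X t → InClosedNbhd E Y t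
  X⊑Y (inj₁ (here refl)) = inj₁ c₁∈Y
  X⊑Y (inj₁ (there (here refl))) = inj₁ c₂∈Y
  X⊑Y (inj₁ (there (there (here refl)))) = inj₂ (v , v∈Y , inj₂ u~v)
  X⊑Y (inj₁ (there (there (there (here refl))))) = inj₂ (v , v∈Y , inj₁ v~w)
  X⊑Y (inj₂ (_ , here refl , e)) = inj₂ (c₁ , c₁∈Y , e)
  X⊑Y (inj₂ (_ , there (here refl) , e)) = inj₂ (c₂ , c₂∈Y , e)
  X⊑Y (inj₂ (_ , there (there (here refl)) , inj₁ e)) = u-neighbours e
  X⊑Y (inj₂ (_ , there (there (here refl)) , inj₂ e)) = u-neighbours (downcoreEdge-sym {D} e)
  X⊑Y (inj₂ (_ , there (there (there (here refl))) , inj₁ e)) = w-neighbours (downcoreEdge-sym {D} e)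
  X⊑Y (inj₂ (_ , there (there (there (here refl))) , inj₂ e)) = w-neighbours e

theorem3p12 : (n : ℕ) (π : Fin n → Fin n) → IsPerm n π → Avoids123 n π →
    DowncorePure (BoundaryGrid n π) → Avoids2143 n π
theorem3p12 n π inj avoids pure occurrence =
  ≤⇒≯ (pure⇒size-bound pure X-independent Y-independent X⊑Y) (n<1+n 3)
  where
  open TightConfiguration inj (tighten inj avoids occurrence)
  open Greedy D E (boundaryGrid? n π) (downcoreEdge? (boundaryGrid? n π)) downcoreEdge-irrefl
              (gridBoxes n) (gridBoxes-complete n π)
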